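{- Let $G=(V,E)$ be an undirected edge-weighted graph, let $p,v\in V$ be distinct, and let $S$ with $v\in S$, $p\notin S$ be a minimum $p,v$-cut. If $|E(\{v\},V\setminus S)|>0.6\cdot\deg(v)$, then for every $v'\in S\setminus\{v\}$ we have $\lambda_{p,v'}\leq 0.8\cdot\lambda_{p,v}$.
   Context: $\deg(u)$ is the weighted degree of $u$, $|E(A,B)|$ is the total weight of edges between $A$ and $B$, and $\lambda_{x,y}$ denotes the value (total crossing weight) of a minimum $x,y$-cut in $G$.
   Formalization: The edge weights of the graph G are rational numbers. -}

module Defs where

open import Data.Bool using (Bool; true; false; _∧_; if_then_else_)
open import Data.Nat using (ℕ; zero; suc)
open import Data.Fin using (Fin; zero; suc)
open import Data.Fin.Subset using (Subset; _∈_; _∉_; ∁)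
open import Data.Vec using (lookup)
open import Data.Rational using (ℚ; 0ℚ; _+_; _≤_)
open import Data.Product using (Σ; _×_)
open import Relation.Binary.PropositionalEquality using (_≡_)

sumFin : ∀ {n} → (Fin n → ℚ) → ℚ
sumFin {zero}  f = 0ℚ
sumFin {suc n} f = f zero + sumFin (λ i → f (suc i))

-- An undirected edge-weighted graph on vertex set Fin n:
-- w x y is the weight of edge {x,y} (0 = no edge); symmetric,
-- nonnegative, no self-loops.
record WGraph (n : ℕ) : Set where
  field
    w        : Fin n → Fin n → ℚ
    w-sym    : ∀ x y → w x y ≡ w y x
    w-nonneg : ∀ x y → 0ℚ ≤ w x y
    w-loop   : ∀ x → w x x ≡ 0ℚ
open WGraph public

-- |E(A,B)| : total weight of edges with one end in A and the other in B
-- (A, B are meant to be disjoint; summed over ordered pairs (a,b), a∈A, b∈B).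
E : ∀ {n} → WGraph n → Subset n → Subset n → ℚ
E G A B = sumFin (λ a → sumFin (λ b →
  if lookup A a ∧ lookup B b then w G a b else 0ℚ))

deg : ∀ {n} → WGraph n → Fin n → ℚ
deg G u = sumFin (λ x → w G u x)

cutValue : ∀ {n} → WGraph n → Subset n → ℚ
cutValue G S = E G S (∁ S)

-- S is an x,y-cut: y ∈ S, x ∉ S (orientation as in the paper: v ∈ S, p ∉ S)
IsCut : ∀ {n} → Fin n → Fin n → Subset n → Set
IsCut x y S = (y ∈ S) × (x ∉ S)

IsMinCut : ∀ {n} → WGraph n → Fin n → Fin n → Subset n → Set
IsMinCut G x y S = IsCut x y S × (∀ T → IsCut x y T → cutValue G S ≤ cutValue G T)

IsMinCutValue : ∀ {n} → WGraph n → Fin n → Fin n → ℚ → Set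
IsMinCutValue G x y c = Σ (Subset _) (λ T → IsMinCut G x y T × (cutValue G T ≡ c))

-- Let l = λ_{p,v}, d = deg v, A = |E({v}, V∖S)| and B = |E({v}, S∖{v})|. Moving v out of S
-- turns the edges from v to V∖S into internal ones and the edges from v to S∖{v} into cut
-- edges, so the p,v'-cut S∖{v} has value l − A + B ≤ l + d − 2A < l − d/5. Since {v} is a
-- p,v-cut, l ≤ d, hence λ_{p,v'} ≤ l − l/5 = (4/5) l.
module Submission where

open import Defs
open import Data.Nat using (ℕ)
open import Data.Integer using (+_)
open import Data.Fin using (Fin)
open import Data.Fin.Subset using (Subset; _∈_; ∁; ⁅_⁆)
open import Data.Rational using (ℚ; _/_; _*_; _<_; _≤_)
open import Relation.Binary.PropositionalEquality using (_≡_)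
open import Relation.Nullary using (¬_)

open import Data.Bool as 𝔹 using (Bool; true; false; _∧_; not; if_then_else_; f≤t; b≤b)
import Data.Bool.Properties as 𝔹
import Data.Nat as ℕ
open import Data.Fin using (zero; suc)
open import Data.Fin.Subset using (_⊆_; _∩_)
open import Data.Fin.Subset.Properties using (x∈⁅x⁆; x∈⁅y⁆⇒x≡y; p∩q⊆p; x∈p∩q⁺; x∉p⇒x∈∁p)
open import Data.Vec using (lookup)
open import Data.Vec.Properties using (lookup-map; lookup-zipWith; lookup-replicate; []=⇒lookup; lookup⇒[]=)
open import Data.Rational using (0ℚ; _+_; -_)
open import Data.Rational.Properties
open import Data.Rational.Solver using (module +-*-Solver)
open import Data.Product using (_,_)
open import Function using (_∘_)
open import Relation.Binary.PropositionalEquality using (refl; sym; trans; cong; cong₂; subst; module ≡-Reasoning)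

infixr 9 [_]·_

[_]·_ : Bool → ℚ → ℚ
[ b ]· r = if b then r else 0ℚ

[]·-∧ : ∀ a b r → [ a ∧ b ]· r ≡ [ a ]· [ b ]· r
[]·-∧ true  b r = refl
[]·-∧ false b r = refl

[]·-≤ : ∀ b {r} → 0ℚ ≤ r → [ b ]· r ≤ r
[]·-≤ true  0≤r = ≤-refl
[]·-≤ false 0≤r = 0≤r

[]·-not-+-≤ : ∀ {a b r} → 0ℚ ≤ r → a 𝔹.≤ b → [ not b ]· r + [ a ]· r ≤ r
[]·-not-+-≤ 0≤r f≤t          = 0≤r
[]·-not-+-≤ 0≤r (b≤b {true})  = ≤-reflexive (+-identityˡ _)
[]·-not-+-≤ 0≤r (b≤b {false}) = ≤-reflexive (+-identityʳ _)

[]·-exchange : ∀ {s u s' u'} r → u 𝔹.≤ s → u' 𝔹.≤ s' →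
  [ (s ∧ not u) ∧ not (s' ∧ not u') ]· r + [ u ∧ not s' ]· r ≡
  [ s ∧ not s' ]· r + [ (s ∧ not u) ∧ u' ]· r
[]·-exchange r f≤t           f≤t           = refl
[]·-exchange r f≤t           (b≤b {true})  = +-comm r 0ℚ
[]·-exchange r f≤t           (b≤b {false}) = refl
[]·-exchange r (b≤b {true})  f≤t           = refl
[]·-exchange r (b≤b {true})  (b≤b {true})  = refl
[]·-exchange r (b≤b {true})  (b≤b {false}) = +-comm 0ℚ r
[]·-exchange r (b≤b {false}) f≤t           = refl
[]·-exchange r (b≤b {false}) (b≤b {true})  = refl
[]·-exchange r (b≤b {false}) (b≤b {false}) = refl

+-cancelʳ-≤ : ∀ {p q} r → p + r ≤ q + r → p ≤ q
+-cancelʳ-≤ {p} {q} r p+r≤q+r = begin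
  p               ≡⟨ solve 2 (λ p r → p := (p :+ r) :+ :- r) refl p r ⟩
  (p + r) + - r   ≤⟨ +-monoˡ-≤ (- r) p+r≤q+r ⟩
  (q + r) + - r   ≡⟨ solve 2 (λ q r → (q :+ r) :+ :- r := q) refl q r ⟩
  q               ∎
  where
  open ≤-Reasoning
  open +-*-Solver

-- Add the hypotheses with weights 1, 1, 1/5 and 2; both sides then contain the term K.
four-fifths-bound : ∀ c a b l d → c + a ≡ l + b → a + b ≤ d → l ≤ d →
  (+ 3 / 5) * d < a → c ≤ (+ 4 / 5) * l
four-fifths-bound c a b l d c+a≡l+b a+b≤d l≤d 3d/5<a = +-cancelʳ-≤ K (begin
  c + K
    ≡⟨ solve 5 (λ c a b l d →
         c :+ K' a b l d := (c :+ a) :+ (a :+ b) :+ (con (+ 1 / 5) :* l :+ con (+ 2 / 1) :* (con (+ 3 / 5) :* d)))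
         refl c a b l d ⟩
  (c + a) + (a + b) + ((+ 1 / 5) * l + (+ 2 / 1) * ((+ 3 / 5) * d))
    ≤⟨ +-mono-≤ (+-mono-≤ (≤-reflexive c+a≡l+b) a+b≤d)
                (+-mono-≤ (*-monoˡ-≤-nonNeg (+ 1 / 5) l≤d) (*-monoˡ-≤-nonNeg (+ 2 / 1) (<⇒≤ 3d/5<a))) ⟩
  (l + b) + d + ((+ 1 / 5) * d + (+ 2 / 1) * a)
    ≡⟨ solve 5 (λ c a b l d →
         (l :+ b) :+ d :+ (con (+ 1 / 5) :* d :+ con (+ 2 / 1) :* a) := con (+ 4 / 5) :* l :+ K' a b l d)
         refl c a b l d ⟩
  (+ 4 / 5) * l + K ∎)
  where
  open ≤-Reasoning
  open +-*-Solver
  K' : ∀ {m} → Polynomial m → Polynomial m → Polynomial m → Polynomial m → Polynomial m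
  K' a b l d = con (+ 2 / 1) :* a :+ b :+ con (+ 1 / 5) :* l :+ con (+ 6 / 5) :* d
  K : ℚ
  K = (+ 2 / 1) * a + b + (+ 1 / 5) * l + (+ 6 / 5) * d

sumFin-cong : ∀ {n} {f g : Fin n → ℚ} → (∀ i → f i ≡ g i) → sumFin f ≡ sumFin g
sumFin-cong {ℕ.zero}  f≡g = refl
sumFin-cong {ℕ.suc n} f≡g = cong₂ _+_ (f≡g zero) (sumFin-cong (f≡g ∘ suc))

sumFin-mono-≤ : ∀ {n} {f g : Fin n → ℚ} → (∀ i → f i ≤ g i) → sumFin f ≤ sumFin g
sumFin-mono-≤ {ℕ.zero}  f≤g = ≤-refl
sumFin-mono-≤ {ℕ.suc n} f≤g = +-mono-≤ (f≤g zero) (sumFin-mono-≤ (f≤g ∘ suc))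

sumFin-distrib-+ : ∀ {n} (f g : Fin n → ℚ) → sumFin (λ i → f i + g i) ≡ sumFin f + sumFin g
sumFin-distrib-+ {ℕ.zero}  f g = refl
sumFin-distrib-+ {ℕ.suc n} f g = begin
  (f zero + g zero) + sumFin (λ i → f (suc i) + g (suc i))
    ≡⟨ cong (_+_ (f zero + g zero)) (sumFin-distrib-+ (f ∘ suc) (g ∘ suc)) ⟩
  (f zero + g zero) + (sumFin (f ∘ suc) + sumFin (g ∘ suc))
    ≡⟨ solve 4 (λ a b F G → (a :+ b) :+ (F :+ G) := (a :+ F) :+ (b :+ G))
         refl (f zero) (g zero) (sumFin (f ∘ suc)) (sumFin (g ∘ suc)) ⟩
  (f zero + sumFin (f ∘ suc)) + (g zero + sumFin (g ∘ suc)) ∎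
  where
  open ≡-Reasoning
  open +-*-Solver

sumFin-0ℚ : ∀ {n} → sumFin {n} (λ _ → 0ℚ) ≡ 0ℚ
sumFin-0ℚ {ℕ.zero}  = refl
sumFin-0ℚ {ℕ.suc n} = trans (+-identityˡ _) (sumFin-0ℚ {n})

sumFin-[]· : ∀ {n} b (f : Fin n → ℚ) → sumFin (λ i → [ b ]· f i) ≡ [ b ]· sumFin f
sumFin-[]·     true  f = refl
sumFin-[]· {n} false f = sumFin-0ℚ {n}

sumFin-⁅⁆ : ∀ {n} (v : Fin n) (f : Fin n → ℚ) → sumFin (λ i → [ lookup ⁅ v ⁆ i ]· f i) ≡ f v
sumFin-⁅⁆ {ℕ.suc n} zero f = begin
  f zero + sumFin (λ i → [ lookup ⁅ zero {n} ⁆ (suc i) ]· f (suc i))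
    ≡⟨ cong (_+_ (f zero)) (trans (sumFin-cong (λ i → cong ([_]· f (suc i)) (lookup-replicate i false))) (sumFin-0ℚ {n})) ⟩
  f zero + 0ℚ
    ≡⟨ +-identityʳ (f zero) ⟩
  f zero ∎
  where open ≡-Reasoning
sumFin-⁅⁆ (suc v) f = trans (+-identityˡ _) (sumFin-⁅⁆ v (f ∘ suc))

lookup-∁ : ∀ {n} (S : Subset n) x → lookup (∁ S) x ≡ not (lookup S x)
lookup-∁ S x = lookup-map x not S

lookup-∩∁ : ∀ {n} (S U : Subset n) x → lookup (S ∩ ∁ U) x ≡ lookup S x ∧ not (lookup U x)
lookup-∩∁ S U x = trans (lookup-zipWith _∧_ x S (∁ U)) (cong (lookup S x ∧_) (lookup-∁ U x))

⊆⇒lookup-≤ : ∀ {n} {U S : Subset n} → U ⊆ S → ∀ x → lookup U x 𝔹.≤ lookup S x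
⊆⇒lookup-≤ {U = U} {S} U⊆S x with lookup U x in eq
... | false = 𝔹.≤-minimum (lookup S x)
... | true  = 𝔹.≤-reflexive (sym ([]=⇒lookup (U⊆S (lookup⇒[]= x U eq))))

x∈p⇒⁅x⁆⊆p : ∀ {n} {x : Fin n} {p : Subset n} → x ∈ p → ⁅ x ⁆ ⊆ p
x∈p⇒⁅x⁆⊆p {x = x} x∈p y∈⁅x⁆ = subst (_∈ _) (sym (x∈⁅y⁆⇒x≡y x y∈⁅x⁆)) x∈p

module _ {n} (G : WGraph n) where

  E-+-cong : ∀ {A B C D A' B' C' D' : Subset n} →
    (∀ x y → [ lookup A x ∧ lookup B y ]· w G x y + [ lookup C x ∧ lookup D y ]· w G x y
           ≡ [ lookup A' x ∧ lookup B' y ]· w G x y + [ lookup C' x ∧ lookup D' y ]· w G x y) →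
    E G A B + E G C D ≡ E G A' B' + E G C' D'
  E-+-cong {A} {B} {C} {D} {A'} {B'} {C'} {D'} pointwise = begin
    E G A B + E G C D
      ≡⟨ sym (merge A B C D) ⟩
    sumFin (λ x → sumFin (λ y → [ lookup A x ∧ lookup B y ]· w G x y + [ lookup C x ∧ lookup D y ]· w G x y))
      ≡⟨ sumFin-cong (λ x → sumFin-cong (pointwise x)) ⟩
    sumFin (λ x → sumFin (λ y → [ lookup A' x ∧ lookup B' y ]· w G x y + [ lookup C' x ∧ lookup D' y ]· w G x y))
      ≡⟨ merge A' B' C' D' ⟩
    E G A' B' + E G C' D' ∎
    where
    open ≡-Reasoning
    merge : ∀ P Q R T →
      sumFin (λ x → sumFin (λ y → [ lookup P x ∧ lookup Q y ]· w G x y + [ lookup R x ∧ lookup T y ]· w G x y))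
      ≡ E G P Q + E G R T
    merge P Q R T = trans
      (sumFin-cong (λ x → sumFin-distrib-+ (λ y → [ lookup P x ∧ lookup Q y ]· w G x y)
                                           (λ y → [ lookup R x ∧ lookup T y ]· w G x y)))
      (sumFin-distrib-+ (λ x → sumFin (λ y → [ lookup P x ∧ lookup Q y ]· w G x y))
                        (λ x → sumFin (λ y → [ lookup R x ∧ lookup T y ]· w G x y)))

  -- Removing U from S: edges from U to V∖S stop being cut, edges from S∖U to U start being cut.
  cutValue-∩∁ : ∀ {S U : Subset n} → U ⊆ S →
    cutValue G (S ∩ ∁ U) + E G U (∁ S) ≡ cutValue G S + E G (S ∩ ∁ U) U
  cutValue-∩∁ {S} {U} U⊆S =
    E-+-cong {S ∩ ∁ U} {∁ (S ∩ ∁ U)} {U} {∁ S} {S} {∁ S} {S ∩ ∁ U} {U} pointwise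
    where
    pointwise : ∀ x y →
      [ lookup (S ∩ ∁ U) x ∧ lookup (∁ (S ∩ ∁ U)) y ]· w G x y + [ lookup U x ∧ lookup (∁ S) y ]· w G x y
      ≡ [ lookup S x ∧ lookup (∁ S) y ]· w G x y + [ lookup (S ∩ ∁ U) x ∧ lookup U y ]· w G x y
    pointwise x y
      rewrite lookup-∁ (S ∩ ∁ U) y | lookup-∁ S y | lookup-∩∁ S U x | lookup-∩∁ S U y
      = []·-exchange (w G x y) (⊆⇒lookup-≤ U⊆S x) (⊆⇒lookup-≤ U⊆S y)

  E-⁅⁆ˡ : ∀ v (B : Subset n) → E G ⁅ v ⁆ B ≡ sumFin (λ y → [ lookup B y ]· w G v y)
  E-⁅⁆ˡ v B = trans
    (sumFin-cong (λ x → trans (sumFin-cong (λ y → []·-∧ (lookup ⁅ v ⁆ x) (lookup B y) (w G x y)))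
                              (sumFin-[]· (lookup ⁅ v ⁆ x) (λ y → [ lookup B y ]· w G x y))))
    (sumFin-⁅⁆ v (λ x → sumFin (λ y → [ lookup B y ]· w G x y)))

  E-⁅⁆ʳ : ∀ (A : Subset n) v → E G A ⁅ v ⁆ ≡ E G ⁅ v ⁆ A
  E-⁅⁆ʳ A v = begin
    E G A ⁅ v ⁆
      ≡⟨ sumFin-cong (λ x → sumFin-cong (λ y → trans (cong ([_]· w G x y) (𝔹.∧-comm (lookup A x) (lookup ⁅ v ⁆ y)))
                                                      ([]·-∧ (lookup ⁅ v ⁆ y) (lookup A x) (w G x y)))) ⟩
    sumFin (λ x → sumFin (λ y → [ lookup ⁅ v ⁆ y ]· [ lookup A x ]· w G x y))
      ≡⟨ sumFin-cong (λ x → sumFin-⁅⁆ v (λ y → [ lookup A x ]· w G x y)) ⟩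
    sumFin (λ x → [ lookup A x ]· w G x v)
      ≡⟨ sumFin-cong (λ x → cong ([ lookup A x ]·_) (w-sym G x v)) ⟩
    sumFin (λ x → [ lookup A x ]· w G v x)
      ≡⟨ sym (E-⁅⁆ˡ v A) ⟩
    E G ⁅ v ⁆ A ∎
    where open ≡-Reasoning

  E-⁅⁆≤deg : ∀ v (B : Subset n) → E G ⁅ v ⁆ B ≤ deg G v
  E-⁅⁆≤deg v B = ≤-trans (≤-reflexive (E-⁅⁆ˡ v B)) (sumFin-mono-≤ (λ y → []·-≤ (lookup B y) (w-nonneg G v y)))

  E-⁅⁆-∁-+-⊆≤deg : ∀ v {S C : Subset n} → C ⊆ S → E G ⁅ v ⁆ (∁ S) + E G ⁅ v ⁆ C ≤ deg G v
  E-⁅⁆-∁-+-⊆≤deg v {S} {C} C⊆S = begin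
    E G ⁅ v ⁆ (∁ S) + E G ⁅ v ⁆ C
      ≡⟨ cong₂ _+_ (E-⁅⁆ˡ v (∁ S)) (E-⁅⁆ˡ v C) ⟩
    sumFin (λ y → [ lookup (∁ S) y ]· w G v y) + sumFin (λ y → [ lookup C y ]· w G v y)
      ≡⟨ sym (sumFin-distrib-+ (λ y → [ lookup (∁ S) y ]· w G v y) (λ y → [ lookup C y ]· w G v y)) ⟩
    sumFin (λ y → [ lookup (∁ S) y ]· w G v y + [ lookup C y ]· w G v y)
      ≤⟨ sumFin-mono-≤ pointwise ⟩
    deg G v ∎
    where
    open ≤-Reasoning
    pointwise : ∀ y → [ lookup (∁ S) y ]· w G v y + [ lookup C y ]· w G v y ≤ w G v y
    pointwise y rewrite lookup-∁ S y = []·-not-+-≤ (w-nonneg G v y) (⊆⇒lookup-≤ C⊆S y)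

lemma4p4 : ∀ {n} (G : WGraph n) (p v : Fin n) → ¬ (p ≡ v) →
    (S : Subset n) → IsMinCut G p v S →
    ((+ 3 / 5) * deg G v < E G ⁅ v ⁆ (∁ S)) →
    ∀ (v' : Fin n) → v' ∈ S → ¬ (v' ≡ v) →
    ∀ (λ' : ℚ) → IsMinCutValue G p v' λ' →
    λ' ≤ (+ 4 / 5) * cutValue G S
lemma4p4 G p v p≢v S ((v∈S , p∉S) , S-min) heavy v' v'∈S v'≢v λ' (T , (_ , T-min) , cutT≡λ') = begin
  λ'                    ≡⟨ sym cutT≡λ' ⟩
  cutValue G T          ≤⟨ T-min S∖v (v'∈S∖v , p∉S ∘ p∩q⊆p S (∁ ⁅ v ⁆)) ⟩
  cutValue G S∖v        ≤⟨ four-fifths-bound _ _ _ _ _ exchange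
                             (E-⁅⁆-∁-+-⊆≤deg G v (p∩q⊆p S (∁ ⁅ v ⁆))) S≤deg heavy ⟩
  (+ 4 / 5) * cutValue G S ∎
  where
  open ≤-Reasoning
  S∖v : Subset _
  S∖v = S ∩ ∁ ⁅ v ⁆
  v'∈S∖v : v' ∈ S∖v
  v'∈S∖v = x∈p∩q⁺ (v'∈S , x∉p⇒x∈∁p (v'≢v ∘ x∈⁅y⁆⇒x≡y v))
  exchange : cutValue G S∖v + E G ⁅ v ⁆ (∁ S) ≡ cutValue G S + E G ⁅ v ⁆ S∖v
  exchange = trans (cutValue-∩∁ G (x∈p⇒⁅x⁆⊆p v∈S)) (cong (_+_ (cutValue G S)) (E-⁅⁆ʳ G S∖v v))
  S≤deg : cutValue G S ≤ deg G v
  S≤deg = ≤-trans (S-min ⁅ v ⁆ (x∈⁅x⁆ v , p≢v ∘ x∈⁅y⁆⇒x≡y v)) (E-⁅⁆≤deg G v (∁ ⁅ v ⁆))
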